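{- For any $k\in\mathcal{K}$, write $k_\bullet=A+B(p+1)$ with integers $t_1\leq A\leq t_1+p$ and $B$. Then (1) if $d_k^{\mathrm{ur}}$ is odd, $A\leq t_2-1$; (2) if $d_k^{\mathrm{ur}}$ is even, $t_2\leq A$.
   Context: $p\geq 11$ is a prime, $a$ is an integer with $2\leq a\leq p-5$, and $s\in\{0,\dots,p-2\}$. For an integer $n$, $\{n\}\in\{0,\dots,p-2\}$ is its residue modulo $p-1$. Put $\delta=\frac{1}{p-1}(\{a+s\}+s-\{a+2s\})\in\{0,1\}$; if $a+s<p-1$ put $t_1=s+\delta$, $t_2=a+s+\delta+2$; if $a+s\geq p-1$ put $t_1=\{a+s\}+\delta+1$, $t_2=s+\delta+1$. Let $k_\varepsilon=2+\{a+2s\}$ and $\mathcal{K}=\{k\geq 2: k\equiv k_\varepsilon\pmod{p-1}\}$; for $k\in\mathcal{K}$ write $k=k_\varepsilon+k_\bullet(p-1)$ and put $d_k^{\mathrm{ur}}=\lfloor\frac{k_\bullet-t_1}{p+1}\rfloor+\lfloor\frac{k_\bullet-t_2}{p+1}\rfloor+2$. -}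

module Defs where

open import Data.Nat as ℕ using (ℕ; zero; suc; _+_; _∸_; _<?_)
open import Data.Nat.DivMod using (_%_; _/_)
open import Data.Integer as ℤ using (ℤ; +_; _/ℕ_)
open import Relation.Nullary.Decidable using (does)
open import Data.Bool using (if_then_else_)

-- {n} : the residue of n modulo p - 1, in {0, …, p-2}.
-- (For p ≥ 2, p ∸ 1 = suc q with q = p ∸ 2; the degenerate
--  cases p = 0, 1 never occur since p ≥ 11 in the statement.)
res : (p n : ℕ) → ℕ
res (suc (suc q)) n = n % suc q
res _             n = n

divPm1 : (p n : ℕ) → ℕ
divPm1 (suc (suc q)) n = n / suc q
divPm1 _             n = n

δ : (p a s : ℕ) → ℕ
δ p a s = divPm1 p ((res p (a + s) + s) ∸ res p (a + s + s))

t₁ : (p a s : ℕ) → ℕ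
t₁ p a s = if does (a + s <? p ∸ 1)
             then s + δ p a s
             else res p (a + s) + δ p a s + 1

t₂ : (p a s : ℕ) → ℕ
t₂ p a s = if does (a + s <? p ∸ 1)
             then a + s + δ p a s + 2
             else s + δ p a s + 1

kε : (p a s : ℕ) → ℕ
kε p a s = 2 + res p (a + s + s)

-- d_k^ur as a function of k_• (floor division by p + 1)
dur : (p a s : ℕ) (kb : ℤ) → ℤ
dur p a s kb =
  ((kb ℤ.- + t₁ p a s) /ℕ suc p) ℤ.+ ((kb ℤ.- + t₂ p a s) /ℕ suc p) ℤ.+ + 2

-- Since t₁ ≤ t₂ ≤ t₁ + (p + 1), writing k_• = A + B(p + 1) with t₁ ≤ A ≤ t₁ + p gives
-- ⌊(k_• − t₁)/(p + 1)⌋ = B, while ⌊(k_• − t₂)/(p + 1)⌋ is B when t₂ ≤ A and B − 1 when A < t₂.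
-- So d_k^ur is 2B + 2 in the first case and 2B + 1 in the second, and its parity tells which.
module Submission where

open import Defs
open import Data.Nat as ℕ using (ℕ)
open import Data.Nat.Primality using (Prime)
open import Data.Integer as ℤ using (ℤ; +_; _+_; _-_; _*_; _≤_)
open import Data.Integer.Divisibility using (_∣_)
open import Relation.Binary.PropositionalEquality using (_≡_)
open import Relation.Nullary using (¬_)
open import Data.Product using (_×_)

open import Data.Nat using (zero; suc; z≤n; s≤s; _≤?_)
import Data.Nat.Properties as ℕ
open import Data.Nat.DivMod using (_%_; m%n≤m; m≤n⇒[n∸m]%m≡n%m)
import Data.Nat.Divisibility as ℕ
open import Data.Integer using (_<_; +≤+; +<+; _/ℕ_; -1ℤ) renaming (suc to sucℤ)
open import Data.Integer.Properties
  using (≤-antisym; +-assoc; +-comm; +-identityˡ; suc-*; +-monoˡ-<; i≤j+i; i<j⇒i≤pred[j];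
         *-cancelʳ-<-nonNeg; m-n≡m⊖n; ⊖-≥; module ≤-Reasoning)
open import Data.Integer.DivMod using ([n/ℕd]*d≤n; n<s[n/ℕd]*d)
import Data.Integer.Divisibility.Signed as Signed
open import Data.Integer.Tactic.RingSolver using (solve-∀)
open import Data.Nat.Tactic.RingSolver using () renaming (solve-∀ to ℕsolve-∀)
open import Relation.Nullary using (yes; no; contradiction; ofʸ; ofⁿ)
open import Data.Bool using (true; false)
open import Relation.Binary.PropositionalEquality
  using (refl; sym; trans; cong; cong₂; subst; module ≡-Reasoning)
open import Data.Product using (_,_)

i<suc[j]⇒i≤j : ∀ {i j} → i < sucℤ j → i ≤ j
i<suc[j]⇒i≤j {i} {j} lt = subst (i ≤_) pred-suc (i<j⇒i≤pred[j] lt)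
  where
  pred-suc : -1ℤ + sucℤ j ≡ j
  pred-suc = trans (sym (+-assoc -1ℤ (+ 1) j)) (+-identityˡ j)

i<j⇒i≤j-1 : ∀ {i j} → i < j → i ≤ j - + 1
i<j⇒i≤j-1 {i} {j} lt = subst (i ≤_) (+-comm -1ℤ j) (i<j⇒i≤pred[j] lt)

/ℕ-unique : ∀ D .{{_ : ℕ.NonZero D}} (q : ℤ) {r : ℕ} → r ℕ.< D → (+ r + q * + D) /ℕ D ≡ q
/ℕ-unique D q {r} r<D = ≤-antisym quotient≤q q≤quotient
  where
  open ≤-Reasoning
  z : ℤ
  z = + r + q * + D

  quotient≤q : z /ℕ D ≤ q
  quotient≤q = i<suc[j]⇒i≤j (*-cancelʳ-<-nonNeg (+ D) (begin-strict
    z /ℕ D * + D   ≤⟨ [n/ℕd]*d≤n z D ⟩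
    z              <⟨ +-monoˡ-< (q * + D) (+<+ r<D) ⟩
    + D + q * + D  ≡⟨ suc-* q (+ D) ⟨
    sucℤ q * + D   ∎))

  q≤quotient : q ≤ z /ℕ D
  q≤quotient = i<suc[j]⇒i≤j (*-cancelʳ-<-nonNeg (+ D) (begin-strict
    q * + D              ≤⟨ i≤j+i (q * + D) (+ r) ⟩
    z                    <⟨ n<s[n/ℕd]*d z D ⟩
    sucℤ (z /ℕ D) * + D  ∎))

+m-+n≡+[m∸n] : ∀ {m n} → n ℕ.≤ m → + m - + n ≡ + (m ℕ.∸ n)
+m-+n≡+[m∸n] {m} {n} n≤m = trans (m-n≡m⊖n m n) (⊖-≥ n≤m)

[r+q*D-t]/ℕD≡q : ∀ D .{{_ : ℕ.NonZero D}} (q : ℤ) {r t : ℕ} →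
  t ℕ.≤ r → r ℕ.< t ℕ.+ D → (+ r + q * + D - + t) /ℕ D ≡ q
[r+q*D-t]/ℕD≡q D q {r} {t} t≤r r<t+D = begin
  (+ r + q * + D - + t) /ℕ D      ≡⟨ cong (_/ℕ D) (regroup (+ r) q (+ D) (+ t)) ⟩
  ((+ r - + t) + q * + D) /ℕ D    ≡⟨ cong (λ x → (x + q * + D) /ℕ D) (+m-+n≡+[m∸n] t≤r) ⟩
  (+ (r ℕ.∸ t) + q * + D) /ℕ D    ≡⟨ /ℕ-unique D q (ℕ.m<n+o⇒m∸n<o r t r<t+D) ⟩
  q                               ∎
  where
  open ≡-Reasoning
  regroup : ∀ x y d u → x + y * d - u ≡ (x - u) + y * d
  regroup = solve-∀

[r+q*D-t]/ℕD≡q-1 : ∀ D .{{_ : ℕ.NonZero D}} (q : ℤ) {r t : ℕ} →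
  r ℕ.< t → t ℕ.≤ r ℕ.+ D → (+ r + q * + D - + t) /ℕ D ≡ q - + 1
[r+q*D-t]/ℕD≡q-1 D q {r} {t} r<t t≤r+D = begin
  (+ r + q * + D - + t) /ℕ D                 ≡⟨ cong (_/ℕ D) (regroup (+ r) q (+ D) (+ t)) ⟩
  ((+ (r ℕ.+ D) - + t) + (q - + 1) * + D) /ℕ D
    ≡⟨ cong (λ x → (x + (q - + 1) * + D) /ℕ D) (+m-+n≡+[m∸n] t≤r+D) ⟩
  (+ (r ℕ.+ D ℕ.∸ t) + (q - + 1) * + D) /ℕ D
    ≡⟨ /ℕ-unique D (q - + 1) (ℕ.m<n+o⇒m∸n<o (r ℕ.+ D) t (ℕ.+-monoˡ-< D r<t)) ⟩
  q - + 1                                    ∎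
  where
  open ≡-Reasoning
  regroup : ∀ x y d u → x + y * d - u ≡ (x + d - u) + (y - + 1) * d
  regroup = solve-∀

[a+s]%m≤s : ∀ m .{{_ : ℕ.NonZero m}} {a s} → a ℕ.≤ m → m ℕ.≤ a ℕ.+ s → (a ℕ.+ s) % m ℕ.≤ s
[a+s]%m≤s m {a} {s} a≤m m≤a+s = begin
  (a ℕ.+ s) % m          ≡⟨ m≤n⇒[n∸m]%m≡n%m m≤a+s ⟨
  (a ℕ.+ s ℕ.∸ m) % m    ≤⟨ m%n≤m _ m ⟩
  a ℕ.+ s ℕ.∸ m          ≤⟨ ℕ.m≤n+o⇒m∸n≤o (a ℕ.+ s) m (ℕ.+-monoˡ-≤ s a≤m) ⟩
  s                      ∎
  where open ℕ.≤-Reasoning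

res[a+s]≤s : ∀ p {a s} → a ℕ.≤ p ℕ.∸ 1 → p ℕ.∸ 1 ℕ.≤ a ℕ.+ s → res p (a ℕ.+ s) ℕ.≤ s
res[a+s]≤s zero          z≤n _ = ℕ.≤-refl
res[a+s]≤s (suc zero)    z≤n _ = ℕ.≤-refl
res[a+s]≤s (suc (suc q)) a≤q+1 q+1≤a+s = [a+s]%m≤s (suc q) a≤q+1 q+1≤a+s

-- In t₁ and t₂ the test  does (a + s <? p ∸ 1)  computes to  a + s <ᵇ p ∸ 1,
-- so that is what we split on.
t₁≤t₂ : ∀ p {a s} → a ℕ.≤ p ℕ.∸ 1 → t₁ p a s ℕ.≤ t₂ p a s
t₁≤t₂ p {a} {s} a≤p-1 with a ℕ.+ s ℕ.<ᵇ p ℕ.∸ 1 | ℕ.<ᵇ-reflects-< (a ℕ.+ s) (p ℕ.∸ 1)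
... | true  | _ = begin
  s ℕ.+ d                  ≤⟨ ℕ.m≤n+m (s ℕ.+ d) a ⟩
  a ℕ.+ (s ℕ.+ d)          ≡⟨ ℕ.+-assoc a s d ⟨
  a ℕ.+ s ℕ.+ d            ≤⟨ ℕ.m≤m+n _ 2 ⟩
  a ℕ.+ s ℕ.+ d ℕ.+ 2      ∎
  where
  open ℕ.≤-Reasoning
  d : ℕ
  d = δ p a s
... | false | ofⁿ a+s≮p-1 =
  ℕ.+-monoˡ-≤ 1 (ℕ.+-monoˡ-≤ (δ p a s) (res[a+s]≤s p a≤p-1 (ℕ.≮⇒≥ a+s≮p-1)))

t₂≤t₁+[1+p] : ∀ p {a s} → s ℕ.≤ p → t₂ p a s ℕ.≤ t₁ p a s ℕ.+ suc p
t₂≤t₁+[1+p] p {a} {s} s≤p with a ℕ.+ s ℕ.<ᵇ p ℕ.∸ 1 | ℕ.<ᵇ-reflects-< (a ℕ.+ s) (p ℕ.∸ 1)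
... | true  | ofʸ a+s<p-1 = begin
  a ℕ.+ s ℕ.+ d ℕ.+ 2      ≡⟨ reorder a s d ⟩
  s ℕ.+ d ℕ.+ (2 ℕ.+ a)    ≤⟨ ℕ.+-monoʳ-≤ (s ℕ.+ d) (s≤s a<p) ⟩
  s ℕ.+ d ℕ.+ suc p        ∎
  where
  open ℕ.≤-Reasoning
  d : ℕ
  d = δ p a s
  reorder : ∀ a s d → a ℕ.+ s ℕ.+ d ℕ.+ 2 ≡ s ℕ.+ d ℕ.+ (2 ℕ.+ a)
  reorder = ℕsolve-∀
  a<p : a ℕ.< p
  a<p = ℕ.≤-trans (ℕ.≤-trans (s≤s (ℕ.m≤m+n a s)) a+s<p-1) (ℕ.m∸n≤m p 1)
... | false | _ = begin
  s ℕ.+ d ℕ.+ 1                     ≡⟨ reorder s d ⟩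
  (d ℕ.+ 1) ℕ.+ s                   ≤⟨ ℕ.+-mono-≤ (ℕ.m≤n+m (d ℕ.+ 1) r) (ℕ.≤-trans s≤p (ℕ.n≤1+n p)) ⟩
  r ℕ.+ (d ℕ.+ 1) ℕ.+ suc p         ≡⟨ cong (ℕ._+ suc p) (ℕ.+-assoc r d 1) ⟨
  r ℕ.+ d ℕ.+ 1 ℕ.+ suc p           ∎
  where
  open ℕ.≤-Reasoning
  d : ℕ
  d = δ p a s
  r : ℕ
  r = res p (a ℕ.+ s)
  reorder : ∀ s d → s ℕ.+ d ℕ.+ 1 ≡ (d ℕ.+ 1) ℕ.+ s
  reorder = ℕsolve-∀

2∣i*2 : ∀ i → + 2 ∣ i * + 2
2∣i*2 i = Signed.∣⇒∣ᵤ (Signed.∣n⇒∣m*n i Signed.∣-refl)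

2∤1+i*2 : ∀ i → ¬ (+ 2 ∣ + 1 + i * + 2)
2∤1+i*2 i 2∣1+i*2 = contradiction (ℕ.∣1⇒≡1 (Signed.∣⇒∣ᵤ 2∣1)) λ ()
  where
  2∣1 : + 2 Signed.∣ + 1
  2∣1 = Signed.∣m+n∣n⇒∣m {n = i * + 2} (Signed.∣ᵤ⇒∣ 2∣1+i*2) (Signed.∣ᵤ⇒∣ (2∣i*2 i))

module _ (p a s : ℕ) {n : ℕ} (B : ℤ) (t₁≤n : t₁ p a s ℕ.≤ n) (n≤t₁+p : n ℕ.≤ t₁ p a s ℕ.+ p) where

  private
    n<t₁+[1+p] : n ℕ.< t₁ p a s ℕ.+ suc p
    n<t₁+[1+p] = subst (n ℕ.<_) (sym (ℕ.+-suc (t₁ p a s) p)) (s≤s n≤t₁+p)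

    ⌊kb-t₁⌋≡B : (+ n + B * + suc p - + t₁ p a s) /ℕ suc p ≡ B
    ⌊kb-t₁⌋≡B = [r+q*D-t]/ℕD≡q (suc p) B t₁≤n n<t₁+[1+p]

  dur≡[B+1]*2 : t₁ p a s ℕ.≤ t₂ p a s → t₂ p a s ℕ.≤ n →
                dur p a s (+ n + B * + suc p) ≡ (B + + 1) * + 2
  dur≡[B+1]*2 t₁≤t₂ t₂≤n = trans (cong₂ (λ x y → x + y + + 2) ⌊kb-t₁⌋≡B ⌊kb-t₂⌋≡B) (regroup B)
    where
    ⌊kb-t₂⌋≡B : (+ n + B * + suc p - + t₂ p a s) /ℕ suc p ≡ B
    ⌊kb-t₂⌋≡B = [r+q*D-t]/ℕD≡q (suc p) B t₂≤n
                  (ℕ.<-≤-trans n<t₁+[1+p] (ℕ.+-monoˡ-≤ (suc p) t₁≤t₂))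
    regroup : ∀ i → i + i + + 2 ≡ (i + + 1) * + 2
    regroup = solve-∀

  dur≡1+B*2 : t₂ p a s ℕ.≤ t₁ p a s ℕ.+ suc p → n ℕ.< t₂ p a s →
              dur p a s (+ n + B * + suc p) ≡ + 1 + B * + 2
  dur≡1+B*2 t₂≤t₁+[1+p] n<t₂ = trans (cong₂ (λ x y → x + y + + 2) ⌊kb-t₁⌋≡B ⌊kb-t₂⌋≡B-1) (regroup B)
    where
    ⌊kb-t₂⌋≡B-1 : (+ n + B * + suc p - + t₂ p a s) /ℕ suc p ≡ B - + 1
    ⌊kb-t₂⌋≡B-1 = [r+q*D-t]/ℕD≡q-1 (suc p) B n<t₂
                    (ℕ.≤-trans t₂≤t₁+[1+p] (ℕ.+-monoˡ-≤ (suc p) t₁≤n))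
    regroup : ∀ i → i + (i - + 1) + + 2 ≡ + 1 + i * + 2
    regroup = solve-∀

corollary3p4 : (p a s : ℕ) → Prime p → 11 ℕ.≤ p →
    2 ℕ.≤ a → a ℕ.≤ p ℕ.∸ 5 → s ℕ.≤ p ℕ.∸ 2 →
    (k : ℕ) (kb : ℤ) → 2 ℕ.≤ k →
    + k ≡ + kε p a s + kb * + (p ℕ.∸ 1) →
    (A B : ℤ) → + t₁ p a s ≤ A → A ≤ + t₁ p a s + + p →
    kb ≡ A + B * + (ℕ.suc p) →
    (¬ (+ 2 ∣ dur p a s kb) → A ≤ + t₂ p a s - + 1)
    × (+ 2 ∣ dur p a s kb → + t₂ p a s ≤ A)
corollary3p4 p a s _ _ _ a≤p∸5 s≤p∸2 _ _ _ _ (+ n) B (+≤+ t₁≤n) (+≤+ n≤t₁+p) refl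
  with t₂ p a s ℕ.≤? n
... | yes t₂≤n = (λ 2∤dur → contradiction 2∣dur 2∤dur) , λ _ → +≤+ t₂≤n
  where
  a≤p∸1 : a ℕ.≤ p ℕ.∸ 1
  a≤p∸1 = ℕ.≤-trans a≤p∸5 (ℕ.∸-monoʳ-≤ p (s≤s z≤n))
  2∣dur : + 2 ∣ dur p a s (+ n + B * + suc p)
  2∣dur = subst (+ 2 ∣_) (sym (dur≡[B+1]*2 p a s B t₁≤n n≤t₁+p (t₁≤t₂ p a≤p∸1) t₂≤n))
                (2∣i*2 (B + + 1))
... | no t₂≰n = (λ _ → i<j⇒i≤j-1 (+<+ n<t₂)) ,
                λ 2∣dur → contradiction (subst (+ 2 ∣_) dur≡1+B*2′ 2∣dur) (2∤1+i*2 B)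
  where
  n<t₂ : n ℕ.< t₂ p a s
  n<t₂ = ℕ.≰⇒> t₂≰n
  s≤p : s ℕ.≤ p
  s≤p = ℕ.≤-trans s≤p∸2 (ℕ.m∸n≤m p 2)
  dur≡1+B*2′ : dur p a s (+ n + B * + suc p) ≡ + 1 + B * + 2
  dur≡1+B*2′ = dur≡1+B*2 p a s B t₁≤n n≤t₁+p (t₂≤t₁+[1+p] p s≤p) n<t₂
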